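{- Let $\mathfrak a_{n,m}$ be the number of $\sigma\in\mathcal{I}_n(010,120)$ with $\max(\sigma)=m$, and let $\mathfrak b_{n,k}=|\mathcal W_{n,k}(010,120)|$. Then for all integers $0<m<n$, $$\mathfrak a_{n,m}=\sum_{p=m+1}^{n}\sum_{j=0}^{m-1}\mathfrak a_{p-1,j}\,\mathfrak b_{n-p,m-j}.$$
   Context: For $n\in\mathbb N$, an inversion sequence of size $n$ is a sequence $\sigma=(\sigma_1,\dots,\sigma_n)\in\mathbb N^n$ with $\sigma_i<i$ for all $i$. An integer sequence contains a pattern $\rho$ (a finite integer sequence such as $010$ or $120$) if it has a subsequence order-isomorphic to $\rho$, and avoids $\rho$ otherwise. $\mathcal{I}_n(P)$ denotes the set of inversion sequences of size $n$ avoiding every pattern in the set $P$. $\mathcal W_{n,k}=\{0,\dots,k-1\}^n$ is the set of words of length $n$ over $\{0,\dots,k-1\}$, and $\mathcal W_{n,k}(P)$ its subset of words avoiding every pattern in $P$. $\max(\sigma)$ is the largest entry of $\sigma$. -}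

module Defs where

open import Data.Nat using (ℕ; zero; suc; _+_; _∸_; _<_; _≤_; _⊔_)
open import Data.Fin using (Fin; toℕ; cast)
open import Data.List using (List; []; _∷_; length; lookup; foldr; map; upTo)
open import Data.Nat.ListAction using (sum)
open import Data.List.Relation.Binary.Sublist.Propositional using (_⊆_)
open import Data.Product using (Σ; ∃; _×_)
open import Data.Refinement using (Refinement)
open import Relation.Binary.PropositionalEquality using (_≡_)
open import Relation.Nullary using (¬_)
open import Function.Bundles using (_⇔_; _↔_)

-- Integer sequences are lists of naturals; positions are 0-indexed.

-- s and ρ are order-isomorphic: same length, and for all positions i, j,
-- s_i < s_j iff ρ_i < ρ_j  (this also forces s_i = s_j iff ρ_i = ρ_j).
OrderIso : List ℕ → List ℕ → Set
OrderIso s ρ = Σ (length s ≡ length ρ) λ eq →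
  ∀ (i j : Fin (length s)) →
    (lookup s i < lookup s j) ⇔ (lookup ρ (cast eq i) < lookup ρ (cast eq j))

Contains : List ℕ → List ℕ → Set
Contains w ρ = ∃ λ s → (s ⊆ w) × OrderIso s ρ

Avoids : List ℕ → List ℕ → Set
Avoids w ρ = ¬ Contains w ρ

pat010 : List ℕ
pat010 = 0 ∷ 1 ∷ 0 ∷ []

pat120 : List ℕ
pat120 = 1 ∷ 2 ∷ 0 ∷ []

-- inversion sequence of size n: σ_i < i (1-indexed), i.e. entry at 0-indexed
-- position i is < i + 1.
IsInversionSeq : ℕ → List ℕ → Set
IsInversionSeq n σ = Σ (length σ ≡ n) λ _ → ∀ (i : Fin (length σ)) → lookup σ i < suc (toℕ i)

IsWord : ℕ → ℕ → List ℕ → Set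
IsWord n k w = Σ (length w ≡ n) λ _ → ∀ (i : Fin (length w)) → lookup w i < k

-- largest entry (only used for nonempty sequences)
maxEntry : List ℕ → ℕ
maxEntry = foldr _⊔_ 0

InvSet : ℕ → ℕ → Set
InvSet n m = Refinement (List ℕ) λ σ →
  IsInversionSeq n σ × Avoids σ pat010 × Avoids σ pat120 × maxEntry σ ≡ m

WordSet : ℕ → ℕ → Set
WordSet n k = Refinement (List ℕ) λ w →
  IsWord n k w × Avoids w pat010 × Avoids w pat120

-- the set A has exactly c elements (proof components are irrelevant)
HasCard : Set → ℕ → Set
HasCard A c = Fin c ↔ A

sumFromTo : ℕ → ℕ → (ℕ → ℕ) → ℕ
sumFromTo lo hi f = sum (map (λ i → f (lo + i)) (upTo (suc hi ∸ lo)))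

module Submission where

-- Cut σ ∈ I_n(010,120) with max σ = m > 0 at the first occurrence of m, at position p; since
-- σ_p < p, we have p ≥ m + 1. The prefix is an inversion sequence of size p − 1 whose maximum
-- j is below m, and every later entry x satisfies j < x ≤ m: x < j would give 120 and x = j
-- would give 010 together with the letters j and m. Subtracting j + 1 therefore turns the
-- suffix into a word of length n − p over {0, …, m − j − 1}. Conversely, any such prefix,
-- the letter m and the lifted word glue to an element of I_n(010,120): an occurrence of either
-- pattern rises from its first to its second letter and ends at or below its first letter, so
-- it can neither start at m nor straddle the cut.

open import Defs
open import Data.Nat using (ℕ; zero; suc; _+_; _*_; _∸_; _<_; _≤_; z≤n; s≤s; s≤s⁻¹; _<?_; _≟_)
open import Data.Nat.Properties
open import Data.Nat.ListAction using (sum)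
open import Data.Fin using (Fin; toℕ) renaming (zero to fzero; suc to fsuc)
open import Data.Fin.Properties using (+↔⊎; *↔×)
open import Data.Fin.Permutation using (↔⇒≡)
open import Data.List using (List; []; _∷_; length; lookup; map; _++_; applyUpTo)
open import Data.List.Properties using (length-map; length-++; map-∘; map-id-local; tabulate-lookup)
open import Data.List.Membership.Propositional using (_∈_)
open import Data.List.Membership.Propositional.Properties using (∈-lookup)
open import Data.List.Membership.DecPropositional _≟_ using (_∈?_)
open import Data.List.Relation.Unary.Any using (here; there)
open import Data.List.Relation.Unary.All as All using (All; []; _∷_)
open import Data.List.Relation.Unary.All.Properties using (tabulate⁺)
  renaming (++⁺ to All-++⁺; ++⁻ˡ to All-++⁻ˡ; ++⁻ʳ to All-++⁻ʳ; map⁺ to All-map⁺)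
open import Data.List.Relation.Binary.Sublist.Propositional using (_⊆_; []; _∷_; _∷ʳ_; ⊆-refl; ⊆-trans; from∈)
open import Data.List.Relation.Binary.Sublist.Propositional.Properties using (All-resp-⊆; map⁺; ++⁺; ++⁺ˡ; ++⁺ʳ)
open import Data.Product using (Σ; ∃; ∃₂; _×_; _,_; proj₁; proj₂; uncurry)
open import Data.Product.Function.NonDependent.Propositional using (_×-↔_)
open import Data.Sum using (_⊎_; inj₁; inj₂; [_,_]′)
open import Data.Sum.Function.Propositional using (_⊎-↔_)
open import Data.Unit using (⊤; tt)
open import Data.Empty using (⊥; ⊥-elim)
open import Data.Irrelevant using ([_])
open import Data.Refinement using (_,_; value; value-injective)
open import Function using (_∘_; id)
open import Function.Bundles using (_↔_; mk↔ₛ′; _⇔_; mk⇔; Equivalence)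
open import Function.Properties.Inverse using (↔-trans; ↔-sym)
open import Relation.Binary using (tri<; tri≈; tri>)
open import Relation.Binary.Definitions using (DecidableEquality)
open import Relation.Binary.PropositionalEquality using (_≡_; _≢_; refl; sym; trans; cong; cong₂; subst; module ≡-Reasoning)
open import Relation.Nullary using (¬_; yes; no)
open import Relation.Nullary.Decidable using (recompute)

Σ< : ℕ → (ℕ → Set) → Set
Σ< k F = Σ ℕ λ i → i < k × F i

Σ<-zero↔ : (F : ℕ → Set) → Fin 0 ↔ Σ< 0 F
Σ<-zero↔ F = mk↔ₛ′ (λ ()) (λ { (_ , () , _) }) (λ { (_ , () , _) }) (λ ())

Σ<-suc↔ : ∀ k (F : ℕ → Set) → (F 0 ⊎ Σ< k (F ∘ suc)) ↔ Σ< (suc k) F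
Σ<-suc↔ k F = mk↔ₛ′ split join split∘join join∘split
  where
  split : F 0 ⊎ Σ< k (F ∘ suc) → Σ< (suc k) F
  split (inj₁ x)           = 0 , s≤s z≤n , x
  split (inj₂ (i , i<k , x)) = suc i , s≤s i<k , x
  join : Σ< (suc k) F → F 0 ⊎ Σ< k (F ∘ suc)
  join (zero  , _       , x) = inj₁ x
  join (suc i , s≤s i<k , x) = inj₂ (i , i<k , x)
  split∘join : ∀ y → split (join y) ≡ y
  split∘join (zero  , s≤s z≤n , x) = refl
  split∘join (suc i , s≤s _   , x) = refl
  join∘split : ∀ y → join (split y) ≡ y
  join∘split (inj₁ _) = refl
  join∘split (inj₂ _) = refl

sum-applyUpTo↔ : ∀ k (g f : ℕ → ℕ) (F : ℕ → Set) → (∀ i → Fin (f i) ↔ F i) →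
                 Fin (sum (map f (applyUpTo g k))) ↔ Σ< k (F ∘ g)
sum-applyUpTo↔ zero    g f F f↔F = Σ<-zero↔ _
sum-applyUpTo↔ (suc k) g f F f↔F =
  ↔-trans (+↔⊎ {f (g 0)})
    (↔-trans (f↔F (g 0) ⊎-↔ sum-applyUpTo↔ k (g ∘ suc) f F f↔F) (Σ<-suc↔ k (F ∘ g)))

sumFromTo↔ : ∀ lo hi (f : ℕ → ℕ) (F : ℕ → Set) → (∀ i → Fin (f i) ↔ F i) →
             Fin (sumFromTo lo hi f) ↔ Σ< (suc hi ∸ lo) (λ i → F (lo + i))
sumFromTo↔ lo hi f F f↔F = sum-applyUpTo↔ (suc hi ∸ lo) id (f ∘ (lo +_)) (F ∘ (lo +_)) (f↔F ∘ (lo +_))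

⊆-++⁻ : ∀ {A : Set} (xs : List A) {ys t} → t ⊆ xs ++ ys →
        ∃₂ λ t₁ t₂ → t ≡ t₁ ++ t₂ × t₁ ⊆ xs × t₂ ⊆ ys
⊆-++⁻ []       t⊆ys        = [] , _ , refl , [] , t⊆ys
⊆-++⁻ (x ∷ xs) (.x ∷ʳ t⊆)  with ⊆-++⁻ xs t⊆
... | t₁ , t₂ , refl , t₁⊆ , t₂⊆ = t₁ , t₂ , refl , x ∷ʳ t₁⊆ , t₂⊆
⊆-++⁻ (x ∷ xs) (refl ∷ t⊆) with ⊆-++⁻ xs t⊆
... | t₁ , t₂ , refl , t₁⊆ , t₂⊆ = x ∷ t₁ , t₂ , refl , refl ∷ t₁⊆ , t₂⊆

⊆-map⁻ : ∀ {A B : Set} (f : A → B) (ys : List A) {t} → t ⊆ map f ys →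
         ∃ λ t′ → t ≡ map f t′ × t′ ⊆ ys
⊆-map⁻ f []       []          = [] , refl , []
⊆-map⁻ f (y ∷ ys) (.(f y) ∷ʳ t⊆) with ⊆-map⁻ f ys t⊆
... | t′ , refl , t′⊆ = t′ , refl , y ∷ʳ t′⊆
⊆-map⁻ f (y ∷ ys) (refl ∷ t⊆)  with ⊆-map⁻ f ys t⊆
... | t′ , refl , t′⊆ = y ∷ t′ , refl , refl ∷ t′⊆

Occurs : (ℕ → ℕ → ℕ → Set) → List ℕ → Set
Occurs R w = ∃₂ λ a b → ∃ λ c → (a ∷ b ∷ c ∷ []) ⊆ w × R a b c

Is010 : ℕ → ℕ → ℕ → Set
Is010 a b c = a < b × c ≡ a

Is120 : ℕ → ℕ → ℕ → Set
Is120 a b c = c < a × a < b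

private
  both : ∀ {x y u v} → x < y → u < v → (x < y) ⇔ (u < v)
  both p q = mk⇔ (λ _ → q) (λ _ → p)
  neither : ∀ {x y u v} → ¬ x < y → ¬ u < v → (x < y) ⇔ (u < v)
  neither p q = mk⇔ (⊥-elim ∘ p) (⊥-elim ∘ q)
  irr : ∀ {x} → ¬ x < x
  irr = <-irrefl refl

contains-010⇔ : ∀ {w} → Contains w pat010 ⇔ Occurs Is010 w
contains-010⇔ = mk⇔ occurs contains
  where
  occurs : ∀ {w} → Contains w pat010 → Occurs Is010 w
  occurs ((a ∷ b ∷ c ∷ []) , s , refl , iso) =
    a , b , c , s , Equivalence.from (iso fzero (fsuc fzero)) (s≤s z≤n) ,
    ≤-antisym (≮⇒≥ (irr ∘ Equivalence.to (iso fzero (fsuc (fsuc fzero)))))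
              (≮⇒≥ (irr ∘ Equivalence.to (iso (fsuc (fsuc fzero)) fzero)))
  contains : ∀ {w} → Occurs Is010 w → Contains w pat010
  contains (a , b , .a , s , a<b , refl) = (a ∷ b ∷ a ∷ []) , s , refl , iso
    where
    iso : ∀ i j → _
    iso fzero               fzero               = neither irr irr
    iso fzero               (fsuc fzero)        = both a<b (s≤s z≤n)
    iso fzero               (fsuc (fsuc fzero)) = neither irr irr
    iso (fsuc fzero)        fzero               = neither (<-asym a<b) λ ()
    iso (fsuc fzero)        (fsuc fzero)        = neither irr irr
    iso (fsuc fzero)        (fsuc (fsuc fzero)) = neither (<-asym a<b) λ ()
    iso (fsuc (fsuc fzero)) fzero               = neither irr irr
    iso (fsuc (fsuc fzero)) (fsuc fzero)        = both a<b (s≤s z≤n)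
    iso (fsuc (fsuc fzero)) (fsuc (fsuc fzero)) = neither irr irr

contains-120⇔ : ∀ {w} → Contains w pat120 ⇔ Occurs Is120 w
contains-120⇔ = mk⇔ occurs contains
  where
  occurs : ∀ {w} → Contains w pat120 → Occurs Is120 w
  occurs ((a ∷ b ∷ c ∷ []) , s , refl , iso) =
    a , b , c , s , Equivalence.from (iso (fsuc (fsuc fzero)) fzero) (s≤s z≤n) ,
    Equivalence.from (iso fzero (fsuc fzero)) (s≤s (s≤s z≤n))
  contains : ∀ {w} → Occurs Is120 w → Contains w pat120
  contains (a , b , c , s , c<a , a<b) = (a ∷ b ∷ c ∷ []) , s , refl , iso
    where
    c<b = <-trans c<a a<b
    iso : ∀ i j → _
    iso fzero               fzero               = neither irr irr
    iso fzero               (fsuc fzero)        = both a<b (s≤s (s≤s z≤n))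
    iso fzero               (fsuc (fsuc fzero)) = neither (<-asym c<a) λ ()
    iso (fsuc fzero)        fzero               = neither (<-asym a<b) λ { (s≤s ()) }
    iso (fsuc fzero)        (fsuc fzero)        = neither irr irr
    iso (fsuc fzero)        (fsuc (fsuc fzero)) = neither (<-asym c<b) λ ()
    iso (fsuc (fsuc fzero)) fzero               = both c<a (s≤s z≤n)
    iso (fsuc (fsuc fzero)) (fsuc fzero)        = both c<b (s≤s z≤n)
    iso (fsuc (fsuc fzero)) (fsuc (fsuc fzero)) = neither irr irr

record PeakPattern : Set₁ where
  field
    ρ               : List ℕ
    Shape           : ℕ → ℕ → ℕ → Set
    contains⇔occurs : ∀ {w} → Contains w ρ ⇔ Occurs Shape w
    first<second    : ∀ {a b c} → Shape a b c → a < b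
    third≤first     : ∀ {a b c} → Shape a b c → c ≤ a
    shift⁺          : ∀ k {a b c} → Shape a b c → Shape (k + a) (k + b) (k + c)
    shift⁻          : ∀ k {a b c} → Shape (k + a) (k + b) (k + c) → Shape a b c

peak010 : PeakPattern
peak010 = record
  { ρ               = pat010
  ; Shape           = Is010
  ; contains⇔occurs = contains-010⇔
  ; first<second    = proj₁
  ; third≤first     = λ { (_ , refl) → ≤-refl }
  ; shift⁺          = λ { k (a<b , refl) → +-monoʳ-< k a<b , refl }
  ; shift⁻          = λ { k (a<b , c≡a) → +-cancelˡ-< k _ _ a<b , +-cancelˡ-≡ k _ _ c≡a }
  }

peak120 : PeakPattern
peak120 = record
  { ρ               = pat120
  ; Shape           = Is120
  ; contains⇔occurs = contains-120⇔
  ; first<second    = proj₂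
  ; third≤first     = <⇒≤ ∘ proj₁
  ; shift⁺          = λ { k (c<a , a<b) → +-monoʳ-< k c<a , +-monoʳ-< k a<b }
  ; shift⁻          = λ { k (c<a , a<b) → +-cancelˡ-< k _ _ c<a , +-cancelˡ-< k _ _ a<b }
  }

module _ (P : PeakPattern) where
  open PeakPattern P

  private
    occurs⇒contains : ∀ {w} → Occurs Shape w → Contains w ρ
    occurs⇒contains = Equivalence.from contains⇔occurs
    contains⇒occurs : ∀ {w} → Contains w ρ → Occurs Shape w
    contains⇒occurs = Equivalence.to contains⇔occurs

  avoids-⊆ : ∀ {xs ys} → xs ⊆ ys → Avoids ys ρ → Avoids xs ρ
  avoids-⊆ xs⊆ys avoid has with contains⇒occurs has
  ... | a , b , c , t⊆xs , r = avoid (occurs⇒contains (a , b , c , ⊆-trans t⊆xs xs⊆ys , r))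

  avoids-shift⁻ : ∀ k {w} → Avoids (map (k +_) w) ρ → Avoids w ρ
  avoids-shift⁻ k avoid has with contains⇒occurs has
  ... | a , b , c , t⊆w , r =
    avoid (occurs⇒contains (k + a , k + b , k + c , map⁺ (k +_) t⊆w , shift⁺ k r))

  avoids-shift⁺ : ∀ k {w} → Avoids w ρ → Avoids (map (k +_) w) ρ
  avoids-shift⁺ k {w} avoid has with contains⇒occurs has
  ... | _ , _ , _ , t⊆ , r with ⊆-map⁻ (k +_) w t⊆
  ... | a ∷ b ∷ c ∷ [] , refl , t′⊆w = avoid (occurs⇒contains (a , b , c , t′⊆w , shift⁻ k r))

  avoids-++-peak : ∀ {j m pre rest} → All (_≤ j) pre → All (j <_) (m ∷ rest) → All (_≤ m) rest →
                   Avoids pre ρ → Avoids rest ρ → Avoids (pre ++ m ∷ rest) ρ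
  avoids-++-peak {j} {m} {pre} {rest} pre≤j j<m∷rest rest≤m avoidPre avoidRest has
    with contains⇒occurs has
  ... | a , b , c , t⊆ , r with ⊆-++⁻ pre t⊆
  ... | t₁ , t₂ , t≡ , t₁⊆ , t₂⊆ = impossible r t₁ t₂ t≡ t₁⊆ t₂⊆
    where
    impossible : ∀ {a b c} → Shape a b c → ∀ t₁ t₂ → a ∷ b ∷ c ∷ [] ≡ t₁ ++ t₂ →
                 t₁ ⊆ pre → t₂ ⊆ m ∷ rest → ⊥
    impossible {a} {b} {c} r [] _ refl _ (_ ∷ʳ t⊆rest) =
      avoidRest (occurs⇒contains (a , b , c , t⊆rest , r))
    impossible r [] _ refl _ (refl ∷ bc⊆rest) with All-resp-⊆ bc⊆rest rest≤m
    ... | b≤m ∷ _ = <⇒≱ (first<second r) b≤m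
    impossible r (_ ∷ []) _ refl a⊆pre bc⊆ with All-resp-⊆ a⊆pre pre≤j | All-resp-⊆ bc⊆ j<m∷rest
    ... | a≤j ∷ _ | _ ∷ j<c ∷ _ = <⇒≱ j<c (≤-trans (third≤first r) a≤j)
    impossible r (_ ∷ _ ∷ []) _ refl ab⊆pre c⊆ with All-resp-⊆ ab⊆pre pre≤j | All-resp-⊆ c⊆ j<m∷rest
    ... | a≤j ∷ _ | j<c ∷ _ = <⇒≱ j<c (≤-trans (third≤first r) a≤j)
    impossible {a} {b} {c} r (_ ∷ _ ∷ _ ∷ []) [] refl t⊆pre _ =
      avoidPre (occurs⇒contains (a , b , c , t⊆pre , r))

above-prefix-max : ∀ {j m pre suf} → j ∈ pre → j < m →
                   Avoids (pre ++ m ∷ suf) pat010 → Avoids (pre ++ m ∷ suf) pat120 → All (j <_) suf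
above-prefix-max {j} {m} {pre} {suf} j∈pre j<m avoid010 avoid120 = All.tabulate above
  where
  above : ∀ {x} → x ∈ suf → j < x
  above {x} x∈suf with <-cmp x j | ++⁺ (from∈ j∈pre) (refl ∷ from∈ x∈suf)
  ... | tri< x<j _ _ | jmx = ⊥-elim (avoid120 (Equivalence.from contains-120⇔ (j , m , x , jmx , x<j , j<m)))
  ... | tri≈ _ x≡j _ | jmx = ⊥-elim (avoid010 (Equivalence.from contains-010⇔ (j , m , x , jmx , j<m , x≡j)))
  ... | tri> _ _ j<x | _   = j<x

maxEntry-upperBound : ∀ xs → All (_≤ maxEntry xs) xs
maxEntry-upperBound []       = []
maxEntry-upperBound (x ∷ xs) = m≤m⊔n x _ ∷ All.map (λ y≤ → ≤-trans y≤ (m≤n⊔m x _)) (maxEntry-upperBound xs)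

maxEntry-least : ∀ {k} xs → All (_≤ k) xs → maxEntry xs ≤ k
maxEntry-least []       []           = z≤n
maxEntry-least (x ∷ xs) (x≤k ∷ xs≤k) = ⊔-lub x≤k (maxEntry-least xs xs≤k)

maxEntry-∈ : ∀ xs → 0 < length xs → maxEntry xs ∈ xs
maxEntry-∈ (x ∷ [])     _ = here (⊔-identityʳ x)
maxEntry-∈ (x ∷ y ∷ ys) _ =
  [ here , (λ x⊔≡m → there (subst (_∈ y ∷ ys) (sym x⊔≡m) (maxEntry-∈ (y ∷ ys) (s≤s z≤n)))) ]′
  (⊔-sel x (maxEntry (y ∷ ys)))

module _ {A : Set} (_≟A_ : DecidableEquality A) where

  splitOn : A → List A → List A × List A
  splitOn m []       = [] , []
  splitOn m (x ∷ xs) with x ≟A m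
  ... | yes _ = [] , xs
  ... | no  _ = x ∷ proj₁ (splitOn m xs) , proj₂ (splitOn m xs)

  splitOn-++ : ∀ {m} xs → m ∈ xs → xs ≡ proj₁ (splitOn m xs) ++ m ∷ proj₂ (splitOn m xs)
  splitOn-++ {m} (x ∷ xs) m∈ with x ≟A m
  splitOn-++ (x ∷ xs) m∈          | yes refl = refl
  splitOn-++ (x ∷ xs) (here refl) | no  x≢m  = ⊥-elim (x≢m refl)
  splitOn-++ (x ∷ xs) (there m∈)  | no  _    = cong (x ∷_) (splitOn-++ xs m∈)

  splitOn-∉ : ∀ m xs → All (_≢ m) (proj₁ (splitOn m xs))
  splitOn-∉ m []       = []
  splitOn-∉ m (x ∷ xs) with x ≟A m
  ... | yes _   = []
  ... | no  x≢m = x≢m ∷ splitOn-∉ m xs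

  splitOn-first : ∀ {m} pre suf → All (_≢ m) pre → splitOn m (pre ++ m ∷ suf) ≡ (pre , suf)
  splitOn-first {m} [] suf [] with m ≟A m
  ... | yes _   = refl
  ... | no  m≢m = ⊥-elim (m≢m refl)
  splitOn-first {m} (x ∷ pre) suf (x≢m ∷ pre≢m) with x ≟A m
  ... | yes x≡m = ⊥-elim (x≢m x≡m)
  ... | no  _   = cong (λ (p , s) → x ∷ p , s) (splitOn-first pre suf pre≢m)

-- xs may fill the (1-indexed) positions k + 1, k + 2, … of an inversion sequence.
InversionFrom : ℕ → List ℕ → Set
InversionFrom k []       = ⊤
InversionFrom k (x ∷ xs) = x < suc k × InversionFrom (suc k) xs

inversionFrom⁺ : ∀ k xs → (∀ i → lookup xs i < suc (k + toℕ i)) → InversionFrom k xs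
inversionFrom⁺ k []       _  = tt
inversionFrom⁺ k (x ∷ xs) lt =
  subst (λ z → x < suc z) (+-identityʳ k) (lt fzero) ,
  inversionFrom⁺ (suc k) xs λ i → subst (λ z → lookup xs i < suc z) (+-suc k (toℕ i)) (lt (fsuc i))

inversionFrom⁻ : ∀ k xs → InversionFrom k xs → ∀ i → lookup xs i < suc (k + toℕ i)
inversionFrom⁻ k (x ∷ xs) (x<  , _)  fzero    = subst (λ z → x < suc z) (sym (+-identityʳ k)) x<
inversionFrom⁻ k (x ∷ xs) (_   , xs<) (fsuc i) =
  subst (λ z → lookup xs i < suc z) (sym (+-suc k (toℕ i))) (inversionFrom⁻ (suc k) xs xs< i)

inversionFrom-++⁺ : ∀ k xs {ys} → InversionFrom k xs → InversionFrom (k + length xs) ys →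
                    InversionFrom k (xs ++ ys)
inversionFrom-++⁺ k []       {ys} _          ys< = subst (λ z → InversionFrom z ys) (+-identityʳ k) ys<
inversionFrom-++⁺ k (x ∷ xs) {ys} (x< , xs<) ys< =
  x< , inversionFrom-++⁺ (suc k) xs xs< (subst (λ z → InversionFrom z ys) (+-suc k (length xs)) ys<)

inversionFrom-++⁻ : ∀ k xs {ys} → InversionFrom k (xs ++ ys) →
                    InversionFrom k xs × InversionFrom (k + length xs) ys
inversionFrom-++⁻ k []       {ys} ys< = tt , subst (λ z → InversionFrom z ys) (sym (+-identityʳ k)) ys<
inversionFrom-++⁻ k (x ∷ xs) {ys} (x< , rest<) with inversionFrom-++⁻ (suc k) xs rest<
... | xs< , ys< = (x< , xs<) , subst (λ z → InversionFrom z ys) (sym (+-suc k (length xs))) ys<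

inversionFrom-all : ∀ k xs → All (_< suc k) xs → InversionFrom k xs
inversionFrom-all k []       []          = tt
inversionFrom-all k (x ∷ xs) (x< ∷ xs<) = x< , inversionFrom-all (suc k) xs (All.map m<n⇒m<1+n xs<)

isWord⁺ : ∀ {n k w} → length w ≡ n → All (_< k) w → IsWord n k w
isWord⁺ {w = w} len w<k = len , λ i → All.lookup w<k (∈-lookup i)

isWord⁻ : ∀ {n k w} → IsWord n k w → All (_< k) w
isWord⁻ {w = w} (_ , w<k) = subst (All _) (tabulate-lookup w) (tabulate⁺ w<k)

shiftDown-< : ∀ {j m x} → j < x → x ≤ m → x ∸ suc j < m ∸ j
shiftDown-< {x = suc x} (s≤s j≤x) x<m = ∸-monoˡ-< x<m j≤x

shiftUp-≤ : ∀ {j m y} → j ≤ m → y < m ∸ j → suc j + y ≤ m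
shiftUp-≤ {j} {m} {y} j≤m y<m∸j = subst (_≤ m) (cong suc (+-comm y j)) (m≤o∸n⇒m+n≤o (suc y) j≤m y<m∸j)

InInvSet : ℕ → ℕ → List ℕ → Set
InInvSet n m σ = IsInversionSeq n σ × Avoids σ pat010 × Avoids σ pat120 × maxEntry σ ≡ m

InWordSet : ℕ → ℕ → List ℕ → Set
InWordSet n k w = IsWord n k w × Avoids w pat010 × Avoids w pat120

glue : ℕ → List ℕ → ℕ → List ℕ → List ℕ
glue m pre j w = pre ++ m ∷ map (suc j +_) w

glue-inInvSet : ∀ {L l m j pre w} → j < m → m ≤ L →
                InInvSet L j pre → InWordSet l (m ∸ j) w → InInvSet (L + suc l) m (glue m pre j w)
glue-inInvSet {L} {l} {m} {j} {pre} {w} j<m m≤L ((refl , pre<) , pre010 , pre120 , maxPre≡j) (w-word , w010 , w120) =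
  (length≡ , inversionFrom⁻ 0 σ inversion) ,
  avoids-++-peak peak010 pre≤j (j<m ∷ rest>j) rest≤m pre010 (avoids-shift⁺ peak010 (suc j) w010) ,
  avoids-++-peak peak120 pre≤j (j<m ∷ rest>j) rest≤m pre120 (avoids-shift⁺ peak120 (suc j) w120) ,
  ≤-antisym (maxEntry-least σ σ≤m) m≤maxEntry
  where
  rest = map (suc j +_) w
  σ = pre ++ m ∷ rest
  w<m∸j = isWord⁻ w-word
  rest>j : All (j <_) rest
  rest>j = All-map⁺ (All.map (λ {y} _ → s≤s (m≤m+n j y)) w<m∸j)
  rest≤m : All (_≤ m) rest
  rest≤m = All-map⁺ (All.map (shiftUp-≤ (<⇒≤ j<m)) w<m∸j)
  pre≤j : All (_≤ j) pre
  pre≤j = subst (λ k → All (_≤ k) pre) maxPre≡j (maxEntry-upperBound pre)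
  σ≤m : All (_≤ m) σ
  σ≤m = All-++⁺ (All.map (λ x≤j → ≤-trans x≤j (<⇒≤ j<m)) pre≤j) (≤-refl ∷ rest≤m)
  m≤maxEntry : m ≤ maxEntry σ
  m≤maxEntry with All-++⁻ʳ pre (maxEntry-upperBound σ)
  ... | m≤ ∷ _ = m≤
  length≡ : length σ ≡ length pre + suc l
  length≡ = trans (length-++ pre) (cong (λ k → length pre + suc k) (trans (length-map _ w) (proj₁ w-word)))
  inversion : InversionFrom 0 σ
  inversion = inversionFrom-++⁺ 0 pre (inversionFrom⁺ 0 pre pre<)
    (inversionFrom-all (length pre) (m ∷ rest) (s≤s m≤L ∷ All.map (λ x≤m → s≤s (≤-trans x≤m m≤L)) rest≤m))

map-+∘∸ : ∀ k xs → All (k ≤_) xs → map (k +_) (map (_∸ k) xs) ≡ xs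
map-+∘∸ k xs k≤xs = trans (sym (map-∘ xs)) (map-id-local (All.map m+[n∸m]≡n k≤xs))

map-∸∘+ : ∀ k xs → map (_∸ k) (map (k +_) xs) ≡ xs
map-∸∘+ k xs = trans (sym (map-∘ xs)) (map-id-local (All.tabulate λ {x} _ → m+n∸m≡n k x))

record Cut (n m : ℕ) (pre suf : List ℕ) : Set where
  field
    peak≤length  : m ≤ length pre
    length≡      : n ≡ length pre + suc (length suf)
    prefix       : InInvSet (length pre) (maxEntry pre) pre
    prefix<peak  : maxEntry pre < m
    suffix-above : All (maxEntry pre <_) suf
    suffix-word  : InWordSet (length suf) (m ∸ maxEntry pre) (map (_∸ suc (maxEntry pre)) suf)

cut : ∀ {n m pre suf} → 0 < m → InInvSet n m (pre ++ m ∷ suf) → All (_≢ m) pre → Cut n m pre suf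
cut {n} {m} {pre} {suf} 0<m ((len , σ<) , σ010 , σ120 , maxσ≡m) pre≢m = record
  { peak≤length  = m≤L
  ; length≡      = trans (sym len) (length-++ pre)
  ; prefix       = (refl , inversionFrom⁻ 0 pre pre-inversion) ,
                   avoids-⊆ peak010 pre⊆σ σ010 , avoids-⊆ peak120 pre⊆σ σ120 , refl
  ; prefix<peak  = j<m
  ; suffix-above = suf>j
  ; suffix-word  = isWord⁺ (length-map _ suf) lowered<m∸j , unshift peak010 σ010 , unshift peak120 σ120
  }
  where
  σ = pre ++ m ∷ suf
  j = maxEntry pre
  σ≤m : All (_≤ m) σ
  σ≤m = subst (λ k → All (_≤ k) σ) maxσ≡m (maxEntry-upperBound σ)
  suf≤m : All (_≤ m) suf
  suf≤m with All-++⁻ʳ pre σ≤m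
  ... | _ ∷ suf≤m = suf≤m
  pre<m : All (_< m) pre
  pre<m = All.zipWith (uncurry ≤∧≢⇒<) (All-++⁻ˡ pre σ≤m , pre≢m)
  split-inversion : InversionFrom 0 pre × InversionFrom (length pre) (m ∷ suf)
  split-inversion = inversionFrom-++⁻ 0 pre (inversionFrom⁺ 0 σ σ<)
  pre-inversion : InversionFrom 0 pre
  pre-inversion = proj₁ split-inversion
  m≤L : m ≤ length pre
  m≤L = s≤s⁻¹ (proj₁ (proj₂ split-inversion))
  j∈pre : j ∈ pre
  j∈pre = maxEntry-∈ pre (≤-trans 0<m m≤L)
  j<m : j < m
  j<m = All.lookup pre<m j∈pre
  suf>j : All (j <_) suf
  suf>j = above-prefix-max j∈pre j<m σ010 σ120
  lowered<m∸j : All (_< m ∸ j) (map (_∸ suc j) suf)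
  lowered<m∸j = All-map⁺ (All.zipWith (uncurry shiftDown-<) (suf>j , suf≤m))
  pre⊆σ : pre ⊆ σ
  pre⊆σ = ++⁺ʳ (m ∷ suf) ⊆-refl
  unshift : (P : PeakPattern) → Avoids σ (PeakPattern.ρ P) → Avoids (map (_∸ suc j) suf) (PeakPattern.ρ P)
  unshift P avoid = avoids-shift⁻ P (suc j)
    (subst (λ v → Avoids v (PeakPattern.ρ P)) (sym (map-+∘∸ (suc j) suf suf>j))
      (avoids-⊆ P (++⁺ˡ pre (m ∷ʳ ⊆-refl)) avoid))

module Decomposition {n m : ℕ} (0<m : 0 < m) (m<n : m < n) where

  -- i = p − (m + 1) for the position p of the first m, and j is the maximum of the prefix.
  Pieces : Set
  Pieces = Σ< (suc n ∸ (m + 1)) λ i → Σ< (suc (m ∸ 1)) λ j →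
             InvSet (m + 1 + i ∸ 1) j × WordSet (n ∸ (m + 1 + i)) (m ∸ j)

  private
    position≡ : ∀ i → m + 1 + i ≡ suc (m + i)
    position≡ i = trans (+-assoc m 1 i) (+-suc m i)

    range-i≡ : suc n ∸ (m + 1) ≡ n ∸ m
    range-i≡ = cong (suc n ∸_) (+-comm m 1)

    range-j≡ : suc (m ∸ 1) ≡ m
    range-j≡ = m+[n∸m]≡n 0<m

  module _ {pre suf : List ℕ} (c : Cut n m pre suf) where
    open Cut c

    private
      i = length pre ∸ m
      j = maxEntry pre

    cut-i< : i < suc n ∸ (m + 1)
    cut-i< = subst (i <_) (sym range-i≡) (∸-monoˡ-< L<n peak≤length)
      where
      L<n : length pre < n
      L<n = subst (length pre <_) (sym length≡) (m<m+n (length pre) (s≤s z≤n))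

    cut-j< : j < suc (m ∸ 1)
    cut-j< = subst (j <_) (sym range-j≡) prefix<peak

    cut-prefix : InInvSet (m + 1 + i ∸ 1) j pre
    cut-prefix = subst (λ L → InInvSet L j pre) L≡ prefix
      where
      L≡ : length pre ≡ m + 1 + i ∸ 1
      L≡ = trans (sym (m+[n∸m]≡n peak≤length)) (cong (_∸ 1) (sym (position≡ i)))

    cut-suffix : InWordSet (n ∸ (m + 1 + i)) (m ∸ j) (map (_∸ suc j) suf)
    cut-suffix = subst (λ l → InWordSet l (m ∸ j) (map (_∸ suc j) suf)) (sym l≡) suffix-word
      where
      open ≡-Reasoning
      L = length pre
      l = length suf
      l≡ : n ∸ (m + 1 + i) ≡ l
      l≡ = begin
        n ∸ (m + 1 + i)         ≡⟨ cong₂ _∸_ length≡ (position≡ i) ⟩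
        L + suc l ∸ suc (m + i) ≡⟨ cong (λ k → L + suc l ∸ suc k) (m+[n∸m]≡n peak≤length) ⟩
        L + suc l ∸ suc L       ≡⟨ cong (_∸ suc L) (+-suc L l) ⟩
        L + l ∸ L               ≡⟨ m+n∸m≡n L l ⟩
        l                       ∎

  assemble : (pre suf : List ℕ) → .(Cut n m pre suf) → Pieces
  assemble pre suf c =
    length pre ∸ m , recompute (_ <? _) (cut-i< c) , maxEntry pre , recompute (_ <? _) (cut-j< c) ,
    (pre , [ cut-prefix c ]) , (map (_∸ suc (maxEntry pre)) suf , [ cut-suffix c ])

  private
    m+i<n : ∀ {i} → i < suc n ∸ (m + 1) → m + i < n
    m+i<n {i} i< = subst (m + i <_) (m+[n∸m]≡n (<⇒≤ m<n)) (+-monoʳ-< m (subst (i <_) range-i≡ i<))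

    glued-length : ∀ {i} → i < suc n ∸ (m + 1) → m + 1 + i ∸ 1 + suc (n ∸ (m + 1 + i)) ≡ n
    glued-length {i} i< rewrite position≡ i = trans (+-suc (m + i) _) (m+[n∸m]≡n (m+i<n i<))

    m≤prefix-length : ∀ i → m ≤ m + 1 + i ∸ 1
    m≤prefix-length i rewrite position≡ i = m≤m+n m i

  glue-pieces : ∀ {i j pre w} → i < suc n ∸ (m + 1) → j < suc (m ∸ 1) →
                InInvSet (m + 1 + i ∸ 1) j pre → InWordSet (n ∸ (m + 1 + i)) (m ∸ j) w →
                InInvSet n m (glue m pre j w)
  glue-pieces {i} {j} {pre} {w} i< j< pre∈ w∈ =
    subst (λ k → InInvSet k m (glue m pre j w)) (glued-length i<)
      (glue-inInvSet (subst (j <_) range-j≡ j<) (m≤prefix-length i) pre∈ w∈)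

  join : Pieces → InvSet n m
  join (i , i< , j , j< , (pre , [ pre∈ ]) , (w , [ w∈ ])) = glue m pre j w , [ glue-pieces i< j< pre∈ w∈ ]

  peak-∈ : ∀ {σ} → InInvSet n m σ → m ∈ σ
  peak-∈ {σ} ((len , _) , _ , _ , maxσ≡m) =
    subst (_∈ σ) maxσ≡m (maxEntry-∈ σ (subst (0 <_) (sym len) (<-trans 0<m m<n)))

  before after : List ℕ → List ℕ
  before σ = proj₁ (splitOn _≟_ m σ)
  after  σ = proj₂ (splitOn _≟_ m σ)

  cut-at-peak : ∀ σ → InInvSet n m σ → Cut n m (before σ) (after σ)
  cut-at-peak σ σ∈ = cut 0<m (subst (InInvSet n m) (splitOn-++ _≟_ σ (peak-∈ σ∈)) σ∈) (splitOn-∉ _≟_ m σ)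

  split : InvSet n m → Pieces
  split (σ , [ σ∈ ]) = assemble (before σ) (after σ) (cut-at-peak σ σ∈)

  private
    assemble-cong : ∀ {pre suf pre′ suf′} .(c : Cut n m pre suf) .(c′ : Cut n m pre′ suf′) →
                    pre ≡ pre′ → suf ≡ suf′ → assemble pre suf c ≡ assemble pre′ suf′ c′
    assemble-cong _ _ refl refl = refl

    pieces-≡ : ∀ {i i′ i< i<′ j j′ j< j<′}
                 {pre : InvSet (m + 1 + i ∸ 1) j} {pre′ : InvSet (m + 1 + i′ ∸ 1) j′}
                 {w : WordSet (n ∸ (m + 1 + i)) (m ∸ j)} {w′ : WordSet (n ∸ (m + 1 + i′)) (m ∸ j′)} →
               i ≡ i′ → j ≡ j′ → value pre ≡ value pre′ → value w ≡ value w′ →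
               _≡_ {A = Pieces} (i , i< , j , j< , pre , w) (i′ , i<′ , j′ , j<′ , pre′ , w′)
    pieces-≡ {i< = i<} {i<′} {j< = j<} {j<′} {pre} {pre′} {w} {w′} refl refl pre≡ w≡
      rewrite <-irrelevant i< i<′ | <-irrelevant j< j<′ | value-injective {v = pre} {pre′} pre≡
            | value-injective {v = w} {w′} w≡ = refl

  split∘join : ∀ x → split (join x) ≡ x
  split∘join (i , i< , j , j< , (pre , [ pre∈ ]) , (w , [ w∈ ])) =
    trans (assemble-cong (cut-at-peak (glue m pre j w) (glue-pieces i< j< pre∈ w∈))
                         (cut 0<m (glue-pieces i< j< pre∈ w∈) pre≢m) (cong proj₁ split≡) (cong proj₂ split≡))
          (pieces-≡ i≡ max≡ refl w≡)
    where
    rest = map (suc j +_) w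
    max≡ : maxEntry pre ≡ j
    max≡ = recompute (maxEntry pre ≟ j) (proj₂ (proj₂ (proj₂ pre∈)))
    L≡ : length pre ≡ m + 1 + i ∸ 1
    L≡ = recompute (length pre ≟ _) (proj₁ (proj₁ pre∈))
    i≡ : length pre ∸ m ≡ i
    i≡ rewrite L≡ | position≡ i = m+n∸m≡n m i
    pre≢m : All (_≢ m) pre
    pre≢m = All.map (λ x≤j x≡m → <-irrefl x≡m (≤-<-trans x≤j (subst (j <_) range-j≡ j<)))
                    (subst (λ k → All (_≤ k) pre) max≡ (maxEntry-upperBound pre))
    split≡ : splitOn _≟_ m (glue m pre j w) ≡ (pre , rest)
    split≡ = splitOn-first _≟_ pre rest pre≢m
    w≡ : map (_∸ suc (maxEntry pre)) rest ≡ w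
    w≡ rewrite max≡ = map-∸∘+ (suc j) w

  join∘split : ∀ σ → join (split σ) ≡ σ
  join∘split (σ , [ σ∈ ]) = value-injective (begin
    glue m pre j (map (_∸ suc j) suf) ≡⟨ cong (λ r → pre ++ m ∷ r) (map-+∘∸ (suc j) suf suf>j) ⟩
    pre ++ m ∷ suf                    ≡⟨ splitOn-++ _≟_ σ m∈σ ⟨
    σ                                 ∎)
    where
    open ≡-Reasoning
    pre = before σ
    suf = after σ
    j = maxEntry pre
    m∈σ : m ∈ σ
    m∈σ = recompute (m ∈? σ) (peak-∈ σ∈)
    suf>j : All (j <_) suf
    suf>j = recompute (All.all? (j <?_) suf) (Cut.suffix-above (cut-at-peak σ σ∈))

  InvSet↔Pieces : InvSet n m ↔ Pieces
  InvSet↔Pieces = mk↔ₛ′ split join split∘join join∘split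

theorem15 : (a b : ℕ → ℕ → ℕ) →
    (∀ n m → HasCard (InvSet n m) (a n m)) →
    (∀ n k → HasCard (WordSet n k) (b n k)) →
    ∀ n m → 0 < m → m < n →
      a n m ≡ sumFromTo (m + 1) n (λ p → sumFromTo 0 (m ∸ 1) (λ j → a (p ∸ 1) j * b (n ∸ p) (m ∸ j)))
theorem15 a b card-a card-b n m 0<m m<n = ↔⇒≡ (↔-trans (card-a n m) (↔-trans InvSet↔Pieces (↔-sym
  (sumFromTo↔ (m + 1) n _ _ λ p → sumFromTo↔ 0 (m ∸ 1) _ _ λ j →
     ↔-trans (*↔× {a (p ∸ 1) j}) (card-a (p ∸ 1) j ×-↔ card-b (n ∸ p) (m ∸ j))))))
  where open Decomposition 0<m m<n
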